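{- Let $n\ge 2$ be a fixed integer. Then there exists $k_0$ such that for all integers $k\ge k_0$, the metric dimension of the $k$-supertoken graph of the complete graph satisfies $\dim(\mathcal{F}_k(K_n))=n-1$.
   Context: For a graph $G$ with vertex set $\{1,\ldots,n\}$ and $k\ge1$, the $k$-supertoken graph $\mathcal{F}_k(G)$ has as vertices all vectors $\mathbf{x}=(x_1,\ldots,x_n)$ of nonnegative integers with $\sum_i x_i=k$, with $\mathbf{x},\mathbf{y}$ adjacent iff $\mathbf{y}=\mathbf{x}-\mathbf{e}_i+\mathbf{e}_j$ for some edge $\{i,j\}$ of $G$ with $x_i\ge1$. A vertex subset $C=\{z_1,\ldots,z_c\}$ is a resolving set if every vertex $u$ is uniquely determined by $(\operatorname{dist}(u,z_1),\ldots,\operatorname{dist}(u,z_c))$; the metric dimension is the minimum size of a resolving set. -}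

module Defs where

open import Data.Nat using (ℕ; zero; suc; _≤_; _∸_; _+_)
open import Data.Fin using (Fin)
open import Data.Vec using (Vec; lookup; updateAt; sum)
open import Data.List using (List; length)
open import Data.List.Relation.Unary.All using (All)
open import Data.List.Relation.Unary.Unique.Propositional using (Unique)
open import Data.List.Membership.Propositional using (_∈_)
open import Data.Product using (Σ; ∃; _×_; _,_)
open import Relation.Binary.PropositionalEquality using (_≡_; _≢_)
open import Function.Bundles using (_⇔_)

-- Vertices of the k-supertoken graph F_k(G) on vertex set {1..n} (here Fin n):
-- vectors of nonnegative integers with coordinate sum k.
IsVertex : (n k : ℕ) → Vec ℕ n → Set
IsVertex n k x = sum x ≡ k

SupertokenAdjKn : {n : ℕ} → Vec ℕ n → Vec ℕ n → Set
SupertokenAdjKn {n} x y =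
  Σ (Fin n) λ i → Σ (Fin n) λ j →
    i ≢ j × 1 ≤ lookup x i × y ≡ updateAt (updateAt x i (λ a → a ∸ 1)) j suc

-- Walk x y m : there is a walk of length m from x to y in F_k(K_n)
-- (adjacency preserves the coordinate sum, so walks stay in the vertex set).
data Walk {n : ℕ} : Vec ℕ n → Vec ℕ n → ℕ → Set where
  here : ∀ {x} → Walk x x 0
  step : ∀ {x y z m} → SupertokenAdjKn x y → Walk y z m → Walk x z (suc m)

Dist : {n : ℕ} → Vec ℕ n → Vec ℕ n → ℕ → Set
Dist x y d = Walk x y d × (∀ m → Walk x y m → d ≤ m)

Resolving : (n k : ℕ) → List (Vec ℕ n) → Set
Resolving n k C =
  All (IsVertex n k) C ×
  (∀ u v → IsVertex n k u → IsVertex n k v →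
     (∀ z → z ∈ C → ∀ d → (Dist u z d ⇔ Dist v z d)) → u ≡ v)

MetricDimensionKn : (n k m : ℕ) → Set
MetricDimensionKn n k m =
  (Σ (List (Vec ℕ n)) λ C → length C ≡ m × Unique C × Resolving n k C) ×
  (∀ C → Resolving n k C → m ≤ length C)

-- For token vectors of equal sum the distance in F_k(K_n) is the number of tokens that must
-- move, Σᵢ (xᵢ ∸ yᵢ). The n − 1 corners k·eⱼ (j ≠ 1) resolve, since the distance from u to
-- k·eⱼ is k − uⱼ. Conversely, a ball of radius D contains m^(n−1) vertices (pad any vector of
-- [0, m)^(n−1) to sum k in the first coordinate), while by the triangle inequality each
-- landmark sees the distances from such a ball in a window of only 2D + 1 values; for a
-- suitable m and D = (n − 1) m this leaves fewer than m^(n−1) distance vectors for n − 2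
-- landmarks.
module Submission where

open import Defs
open import Data.Nat.Properties
open import Algebra.Properties.CommutativeSemigroup +-commutativeSemigroup
  using () renaming (interchange to +-interchange)
open import Algebra.Properties.CommutativeSemigroup *-commutativeSemigroup
  using () renaming (interchange to *-interchange)
open import Data.Nat using (ℕ; zero; suc; _≤_; _<_; _∸_; _+_; _*_; _^_; z≤n; s≤s; s≤s⁻¹)
open import Data.Fin using (Fin; zero; suc; toℕ; fromℕ<; finToFun; funToFin; combine)
import Data.Fin as Fin
import Data.Fin.Properties as Finₚ
open import Data.Vec using (Vec; []; _∷_; lookup; updateAt; sum; replicate; tabulate; tail)
open import Data.Vec.Properties using (lookup∘tabulate; lookup∘updateAt′; tabulate∘lookup; tabulate-cong)
open import Data.List using (List; length)
import Data.List as List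
open import Data.List.Properties using (length-tabulate)
open import Data.List.Relation.Unary.All using (All)
import Data.List.Relation.Unary.All as All
import Data.List.Relation.Unary.All.Properties as All
open import Data.List.Relation.Unary.Any using (index)
open import Data.List.Relation.Unary.Any.Properties using (lookup-index)
open import Data.List.Relation.Unary.Unique.Propositional using (Unique)
import Data.List.Relation.Unary.Unique.Propositional.Properties as Unique
open import Data.List.Membership.Propositional using (_∈_)
open import Data.List.Membership.Propositional.Properties using (∈-tabulate⁺)
open import Data.Product using (∃; ∃₂; _×_; _,_)
open import Function using (_∘_)
open import Function.Bundles using (_⇔_; mk⇔; Equivalence)
open import Function.Definitions using (Injective)
open import Relation.Binary.PropositionalEquality
open import Relation.Nullary using (¬_; yes; no)

-- For vectors of equal sum this is ½‖x − y‖₁.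
surplus : ∀ {n} → Vec ℕ n → Vec ℕ n → ℕ
surplus []      []      = 0
surplus (a ∷ x) (b ∷ y) = (a ∸ b) + surplus x y

m∸n+n≡n∸m+m : ∀ m n → (m ∸ n) + n ≡ (n ∸ m) + m
m∸n+n≡n∸m+m zero    zero    = refl
m∸n+n≡n∸m+m zero    (suc n) = sym (+-identityʳ (suc n))
m∸n+n≡n∸m+m (suc m) zero    = +-identityʳ (suc m)
m∸n+n≡n∸m+m (suc m) (suc n) = begin
  (m ∸ n) + suc n   ≡⟨ +-suc (m ∸ n) n ⟩
  suc (m ∸ n + n)   ≡⟨ cong suc (m∸n+n≡n∸m+m m n) ⟩
  suc (n ∸ m + m)   ≡⟨ +-suc (n ∸ m) m ⟨
  (n ∸ m) + suc m   ∎
  where open ≡-Reasoning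

∸-triangle : ∀ m n o → m ∸ o ≤ (m ∸ n) + (n ∸ o)
∸-triangle zero    n       o       = ≤-trans (≤-reflexive (0∸n≡0 o)) z≤n
∸-triangle (suc m) zero    o       = ≤-trans (m∸n≤m (suc m) o) (m≤m+n (suc m) (0 ∸ o))
∸-triangle (suc m) (suc n) zero    = ≤-trans (s≤s (∸-triangle m n zero)) (≤-reflexive (sym (+-suc (m ∸ n) n)))
∸-triangle (suc m) (suc n) (suc o) = ∸-triangle m n o

surplus-self : ∀ {n} (x : Vec ℕ n) → surplus x x ≡ 0
surplus-self []      = refl
surplus-self (a ∷ x) = cong₂ _+_ (n∸n≡0 a) (surplus-self x)

surplus-+-sum : ∀ {n} (x y : Vec ℕ n) → surplus x y + sum y ≡ surplus y x + sum x
surplus-+-sum []      []      = refl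
surplus-+-sum (a ∷ x) (b ∷ y) = begin
  ((a ∸ b) + surplus x y) + (b + sum y)   ≡⟨ +-interchange (a ∸ b) (surplus x y) b (sum y) ⟩
  ((a ∸ b) + b) + (surplus x y + sum y)   ≡⟨ cong₂ _+_ (m∸n+n≡n∸m+m a b) (surplus-+-sum x y) ⟩
  ((b ∸ a) + a) + (surplus y x + sum x)   ≡⟨ +-interchange (b ∸ a) (surplus y x) a (sum x) ⟨
  ((b ∸ a) + surplus y x) + (a + sum x)   ∎
  where open ≡-Reasoning

surplus-sym : ∀ {n} (x y : Vec ℕ n) → sum x ≡ sum y → surplus x y ≡ surplus y x
surplus-sym x y s =
  +-cancelʳ-≡ (sum x) _ _ (trans (cong (surplus x y +_) s) (surplus-+-sum x y))

surplus-triangle : ∀ {n} (x y z : Vec ℕ n) → surplus x z ≤ surplus x y + surplus y z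
surplus-triangle []      []      []      = z≤n
surplus-triangle (a ∷ x) (b ∷ y) (c ∷ z) = begin
  (a ∸ c) + surplus x z                         ≤⟨ +-mono-≤ (∸-triangle a b c) (surplus-triangle x y z) ⟩
  ((a ∸ b) + (b ∸ c)) + (surplus x y + surplus y z) ≡⟨ +-interchange (a ∸ b) (b ∸ c) (surplus x y) (surplus y z) ⟩
  ((a ∸ b) + surplus x y) + ((b ∸ c) + surplus y z) ∎
  where open ≤-Reasoning

surplus-antisym : ∀ {n} (x y : Vec ℕ n) → surplus x y ≡ 0 → surplus y x ≡ 0 → x ≡ y
surplus-antisym []      []      _   _   = refl
surplus-antisym (a ∷ x) (b ∷ y) xy0 yx0 = cong₂ _∷_
  (≤-antisym (m∸n≡0⇒m≤n (m+n≡0⇒m≡0 (a ∸ b) xy0)) (m∸n≡0⇒m≤n (m+n≡0⇒m≡0 (b ∸ a) yx0)))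
  (surplus-antisym x y (m+n≡0⇒n≡0 (a ∸ b) xy0) (m+n≡0⇒n≡0 (b ∸ a) yx0))

surplus>0⇒exceeds : ∀ {n} (x y : Vec ℕ n) → 0 < surplus x y → ∃ λ i → lookup y i < lookup x i
surplus>0⇒exceeds []      []      ()
surplus>0⇒exceeds (a ∷ x) (b ∷ y) pos with b <? a
... | yes b<a = zero , b<a
... | no  b≮a with i , yᵢ<xᵢ ← surplus>0⇒exceeds x y (subst (0 <_) (cong (_+ surplus x y) (m≤n⇒m∸n≡0 (≮⇒≥ b≮a))) pos)
  = suc i , yᵢ<xᵢ

move : ∀ {n} → Fin n → Fin n → Vec ℕ n → Vec ℕ n
move i j x = updateAt (updateAt x i (_∸ 1)) j suc

surplus-updateAt-∸1 : ∀ {n} (x : Vec ℕ n) i → surplus x (updateAt x i (_∸ 1)) ≤ 1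
surplus-updateAt-∸1 (zero  ∷ x) zero    = ≤-trans (≤-reflexive (surplus-self x)) z≤n
surplus-updateAt-∸1 (suc a ∷ x) zero    = ≤-reflexive (cong₂ _+_ (m∸[m∸n]≡n (s≤s (z≤n {a}))) (surplus-self x))
surplus-updateAt-∸1 (a     ∷ x) (suc i) =
  ≤-trans (≤-reflexive (cong (_+ surplus x (updateAt x i (_∸ 1))) (n∸n≡0 a))) (surplus-updateAt-∸1 x i)

surplus-updateAt-suc : ∀ {n} (x y : Vec ℕ n) j → surplus x (updateAt y j suc) ≤ surplus x y
surplus-updateAt-suc (a ∷ x) (b ∷ y) zero    = +-monoˡ-≤ (surplus x y) (∸-monoʳ-≤ a (n≤1+n b))
surplus-updateAt-suc (a ∷ x) (b ∷ y) (suc j) = +-monoʳ-≤ (a ∸ b) (surplus-updateAt-suc x y j)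

walk⇒surplus≤ : ∀ {n} {x z : Vec ℕ n} {m} → Walk x z m → surplus x z ≤ m
walk⇒surplus≤ {x = x} here = ≤-reflexive (surplus-self x)
walk⇒surplus≤ {x = x} {z} (step {y = y} (i , j , _ , _ , refl) w) = begin
  surplus x z                ≤⟨ surplus-triangle x y z ⟩
  surplus x y + surplus y z  ≤⟨ +-mono-≤ move≤1 (walk⇒surplus≤ w) ⟩
  1 + _                      ∎
  where
  open ≤-Reasoning
  move≤1 : surplus x (move i j x) ≤ 1
  move≤1 = ≤-trans (surplus-updateAt-suc x _ j) (surplus-updateAt-∸1 x i)

sum-updateAt-suc : ∀ {n} (x : Vec ℕ n) j → sum (updateAt x j suc) ≡ suc (sum x)
sum-updateAt-suc (a ∷ x) zero    = refl
sum-updateAt-suc (a ∷ x) (suc j) = trans (cong (a +_) (sum-updateAt-suc x j)) (+-suc a (sum x))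

sum-updateAt-∸1 : ∀ {n} (x : Vec ℕ n) i → 1 ≤ lookup x i → suc (sum (updateAt x i (_∸ 1))) ≡ sum x
sum-updateAt-∸1 (suc a ∷ x) zero    _   = refl
sum-updateAt-∸1 (a     ∷ x) (suc i) 1≤xᵢ = trans (sym (+-suc a _)) (cong (a +_) (sum-updateAt-∸1 x i 1≤xᵢ))

sum-move : ∀ {n} (x : Vec ℕ n) i j → 1 ≤ lookup x i → sum (move i j x) ≡ sum x
sum-move x i j 1≤xᵢ = trans (sum-updateAt-suc (updateAt x i (_∸ 1)) j) (sum-updateAt-∸1 x i 1≤xᵢ)

surplus-updateAt-∸1-exceeding : ∀ {n} (x z : Vec ℕ n) i → lookup z i < lookup x i →
  suc (surplus (updateAt x i (_∸ 1)) z) ≡ surplus x z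
surplus-updateAt-∸1-exceeding (suc a ∷ x) (b ∷ z) zero    (s≤s b≤a) = cong (_+ surplus x z) (sym (+-∸-assoc 1 b≤a))
surplus-updateAt-∸1-exceeding (a     ∷ x) (b ∷ z) (suc i) zᵢ<xᵢ =
  trans (sym (+-suc (a ∸ b) _)) (cong ((a ∸ b) +_) (surplus-updateAt-∸1-exceeding x z i zᵢ<xᵢ))

surplus-updateAt-suc-deficient : ∀ {n} (x z : Vec ℕ n) j → lookup x j < lookup z j →
  surplus (updateAt x j suc) z ≡ surplus x z
surplus-updateAt-suc-deficient (a ∷ x) (suc b ∷ z) zero    (s≤s a≤b) =
  cong (_+ surplus x z) (trans (m≤n⇒m∸n≡0 a≤b) (sym (m≤n⇒m∸n≡0 (m≤n⇒m≤1+n a≤b))))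
surplus-updateAt-suc-deficient (a ∷ x) (b ∷ z) (suc j) xⱼ<zⱼ =
  cong ((a ∸ b) +_) (surplus-updateAt-suc-deficient x z j xⱼ<zⱼ)

surplus-move : ∀ {n} (x z : Vec ℕ n) {i j} → lookup z i < lookup x i → lookup x j < lookup z j →
  suc (surplus (move i j x) z) ≡ surplus x z
surplus-move x z {i} {j} zᵢ<xᵢ xⱼ<zⱼ = begin
  suc (surplus (move i j x) z)
    ≡⟨ cong suc (surplus-updateAt-suc-deficient (updateAt x i (_∸ 1)) z j (subst (_< lookup z j) (sym xⱼ-unchanged) xⱼ<zⱼ)) ⟩
  suc (surplus (updateAt x i (_∸ 1)) z)
    ≡⟨ surplus-updateAt-∸1-exceeding x z i zᵢ<xᵢ ⟩
  surplus x z ∎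
  where
  open ≡-Reasoning
  xⱼ-unchanged : lookup (updateAt x i (_∸ 1)) j ≡ lookup x j
  xⱼ-unchanged = lookup∘updateAt′ j i (λ { refl → <-asym zᵢ<xᵢ xⱼ<zⱼ }) x

walk-of-surplus : ∀ {n} d {x z : Vec ℕ n} → sum x ≡ sum z → surplus x z ≡ d → Walk x z d
walk-of-surplus zero {x} {z} s xz0 =
  subst (λ y → Walk x y 0) (surplus-antisym x z xz0 zx0) here
  where
  zx0 : surplus z x ≡ 0
  zx0 = trans (sym (surplus-sym x z s)) xz0
walk-of-surplus (suc d) {x} {z} s xz
  with i , zᵢ<xᵢ ← surplus>0⇒exceeds x z (subst (0 <_) (sym xz) (s≤s z≤n))
     | j , xⱼ<zⱼ ← surplus>0⇒exceeds z x (subst (0 <_) (sym (trans (sym (surplus-sym x z s)) xz)) (s≤s z≤n))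
  = step (i , j , (λ { refl → <-asym zᵢ<xᵢ xⱼ<zⱼ }) , 1≤xᵢ , refl)
         (walk-of-surplus d (trans (sum-move x i j 1≤xᵢ) s) (suc-injective (trans (surplus-move x z zᵢ<xᵢ xⱼ<zⱼ) xz)))
  where
  1≤xᵢ : 1 ≤ lookup x i
  1≤xᵢ = ≤-trans (s≤s z≤n) zᵢ<xᵢ

Dist-surplus : ∀ {n} {x z : Vec ℕ n} → sum x ≡ sum z → Dist x z (surplus x z)
Dist-surplus s = walk-of-surplus _ s refl , λ _ → walk⇒surplus≤

Dist-unique : ∀ {n} {x z : Vec ℕ n} {d d′} → Dist x z d → Dist x z d′ → d ≡ d′
Dist-unique (w , shortest) (w′ , shortest′) = ≤-antisym (shortest _ w′) (shortest′ _ w)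

sameDist⇔sameSurplus : ∀ {n} {u v z : Vec ℕ n} → sum u ≡ sum z → sum v ≡ sum z →
  (∀ d → Dist u z d ⇔ Dist v z d) ⇔ (surplus u z ≡ surplus v z)
sameDist⇔sameSurplus {u = u} {v} {z} su sv = mk⇔
  (λ same → Dist-unique (Equivalence.to (same _) (Dist-surplus su)) (Dist-surplus sv))
  (λ eq d → mk⇔
    (λ D → subst (Dist v z) (sym (trans (Dist-unique D (Dist-surplus su)) eq)) (Dist-surplus sv))
    (λ D → subst (Dist u z) (sym (trans (Dist-unique D (Dist-surplus sv)) (sym eq))) (Dist-surplus su)))

SeparatesBySurplus : (n k : ℕ) → List (Vec ℕ n) → Set
SeparatesBySurplus n k C = ∀ u v → IsVertex n k u → IsVertex n k v →
  (∀ z → z ∈ C → surplus u z ≡ surplus v z) → u ≡ v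

resolving⇒separatesBySurplus : ∀ {n k C} → Resolving n k C → SeparatesBySurplus n k C
resolving⇒separatesBySurplus (vertices , resolves) u v su sv same =
  resolves u v su sv λ z z∈C → let sz = All.lookup vertices z∈C in
    Equivalence.from (sameDist⇔sameSurplus (trans su (sym sz)) (trans sv (sym sz))) (same z z∈C)

separatesBySurplus⇒resolving : ∀ {n k C} → All (IsVertex n k) C → SeparatesBySurplus n k C → Resolving n k C
separatesBySurplus⇒resolving vertices separates = vertices , λ u v su sv sameDist →
  separates u v su sv λ z z∈C → let sz = All.lookup vertices z∈C in
    Equivalence.to (sameDist⇔sameSurplus (trans su (sym sz)) (trans sv (sym sz))) (sameDist z z∈C)

corner : ∀ {n} → ℕ → Fin n → Vec ℕ n
corner k zero    = k ∷ replicate _ 0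
corner k (suc j) = 0 ∷ corner k j

sum-replicate-0 : ∀ n → sum (replicate n 0) ≡ 0
sum-replicate-0 zero    = refl
sum-replicate-0 (suc n) = sum-replicate-0 n

sum-corner : ∀ {n} k (j : Fin n) → sum (corner k j) ≡ k
sum-corner {suc n} k zero    = trans (cong (k +_) (sum-replicate-0 n)) (+-identityʳ k)
sum-corner         k (suc j) = sum-corner k j

surplus-replicate-0ˡ : ∀ {n} (u : Vec ℕ n) → surplus (replicate n 0) u ≡ 0
surplus-replicate-0ˡ []      = refl
surplus-replicate-0ˡ (a ∷ u) = cong₂ _+_ (0∸n≡0 a) (surplus-replicate-0ˡ u)

surplus-replicate-0ʳ : ∀ {n} (u : Vec ℕ n) → surplus u (replicate n 0) ≡ sum u
surplus-replicate-0ʳ []      = refl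
surplus-replicate-0ʳ (a ∷ u) = cong (a +_) (surplus-replicate-0ʳ u)

surplus-corner : ∀ {n} k (j : Fin n) (u : Vec ℕ n) → surplus (corner k j) u ≡ k ∸ lookup u j
surplus-corner k zero    (a ∷ u) = trans (cong ((k ∸ a) +_) (surplus-replicate-0ˡ u)) (+-identityʳ _)
surplus-corner k (suc j) (a ∷ u) = trans (cong (_+ surplus (corner k j) u) (0∸n≡0 a)) (surplus-corner k j u)

corner-injective : ∀ {n} k → 1 ≤ k → Injective _≡_ _≡_ (corner {n} k)
corner-injective k         _   {zero}  {zero}  _  = refl
corner-injective (suc k)   _   {zero}  {suc j} ()
corner-injective (suc k)   _   {suc i} {zero}  ()
corner-injective k         1≤k {suc i} {suc j} eq = cong suc (corner-injective k 1≤k (cong tail eq))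

lookup≤sum : ∀ {n} (u : Vec ℕ n) j → lookup u j ≤ sum u
lookup≤sum (a ∷ u) zero    = m≤m+n a (sum u)
lookup≤sum (a ∷ u) (suc j) = ≤-trans (lookup≤sum u j) (m≤n+m (sum u) a)

lookup-via-corner : ∀ {n k} (u : Vec ℕ n) j → sum u ≡ k → lookup u j ≡ k ∸ surplus u (corner k j)
lookup-via-corner {k = k} u j su = begin
  lookup u j                   ≡⟨ m∸[m∸n]≡n (≤-trans (lookup≤sum u j) (≤-reflexive su)) ⟨
  k ∸ (k ∸ lookup u j)         ≡⟨ cong (k ∸_) (surplus-corner k j u) ⟨
  k ∸ surplus (corner k j) u   ≡⟨ cong (k ∸_) (surplus-sym u (corner k j) (trans su (sym (sum-corner k j)))) ⟨
  k ∸ surplus u (corner k j)   ∎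
  where open ≡-Reasoning

-- Every corner except the first: the first coordinate is then fixed by the sum.
corners : ∀ {n} → ℕ → List (Vec ℕ (suc n))
corners k = List.tabulate (corner k ∘ suc)

length-corners : ∀ {n} k → length (corners {n} k) ≡ n
length-corners k = length-tabulate (corner k ∘ suc)

corners-separate : ∀ {n} k → SeparatesBySurplus (suc n) k (corners k)
corners-separate k (a ∷ x) (b ∷ y) su sv same = cong₂ _∷_ heads-equal tails-equal
  where
  coordinate : ∀ j → lookup x j ≡ lookup y j
  coordinate j = begin
    lookup x j                                   ≡⟨ lookup-via-corner (a ∷ x) (suc j) su ⟩
    k ∸ surplus (a ∷ x) (corner k (suc j))       ≡⟨ cong (k ∸_) (same _ (∈-tabulate⁺ j)) ⟩
    k ∸ surplus (b ∷ y) (corner k (suc j))       ≡⟨ lookup-via-corner (b ∷ y) (suc j) sv ⟨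
    lookup y j                                   ∎
    where open ≡-Reasoning
  tails-equal : x ≡ y
  tails-equal = trans (sym (tabulate∘lookup x)) (trans (tabulate-cong coordinate) (tabulate∘lookup y))
  heads-equal : a ≡ b
  heads-equal = +-cancelʳ-≡ (sum x) a b (trans (trans su (sym sv)) (cong (λ t → b + sum t) (sym tails-equal)))

corners-resolving : ∀ {n} k → Resolving (suc n) k (corners k)
corners-resolving k = separatesBySurplus⇒resolving (All.tabulate⁺ (sum-corner k ∘ suc)) (corners-separate k)

corners-unique : ∀ {n} k → 1 ≤ k → Unique (corners {n} k)
corners-unique k 1≤k = Unique.tabulate⁺ (Finₚ.suc-injective ∘ corner-injective k 1≤k)

-- If u is within D of b, the triangle inequality through b confines surplus u z to
-- [surplus b z − D, surplus b z + D]; offset shifts that window to [0, 2D].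
offset : ∀ {n} → ℕ → (b u z : Vec ℕ n) → ℕ
offset D b u z = (surplus u z + D) ∸ surplus b z

offset< : ∀ {n D} (b u z : Vec ℕ n) → surplus u b ≤ D → offset D b u z < suc (D + D)
offset< {D = D} b u z ub≤D = s≤s (m≤n+o⇒m∸n≤o (surplus u z + D) (surplus b z) (begin
  surplus u z + D                    ≤⟨ +-monoˡ-≤ D (surplus-triangle u b z) ⟩
  (surplus u b + surplus b z) + D    ≤⟨ +-monoˡ-≤ D (+-monoˡ-≤ (surplus b z) ub≤D) ⟩
  (D + surplus b z) + D              ≡⟨ cong (_+ D) (+-comm D (surplus b z)) ⟩
  (surplus b z + D) + D              ≡⟨ +-assoc (surplus b z) D D ⟩
  surplus b z + (D + D)              ∎))
  where open ≤-Reasoning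

offset-injective : ∀ {n D} (b u v z : Vec ℕ n) → surplus b u ≤ D → surplus b v ≤ D →
  offset D b u z ≡ offset D b v z → surplus u z ≡ surplus v z
offset-injective {D = D} b u v z bu≤D bv≤D eq = +-cancelʳ-≡ D _ _ (begin
  surplus u z + D                 ≡⟨ m∸n+n≡m (below u bu≤D) ⟨
  offset D b u z + surplus b z    ≡⟨ cong (_+ surplus b z) eq ⟩
  offset D b v z + surplus b z    ≡⟨ m∸n+n≡m (below v bv≤D) ⟩
  surplus v z + D                 ∎)
  where
  open ≡-Reasoning
  below : ∀ w → surplus b w ≤ D → surplus b z ≤ surplus w z + D
  below w bw≤D = ≤-trans (surplus-triangle b w z)
    (≤-trans (+-monoˡ-≤ (surplus w z) bw≤D) (≤-reflexive (+-comm D (surplus w z))))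

pigeonhole-pointwise : ∀ {N c W} → W ^ c < N → (f : Fin N → Fin c → Fin W) →
  ∃₂ λ i j → i Fin.< j × (∀ t → f i t ≡ f j t)
pigeonhole-pointwise lt f with i , j , i<j , eq ← Finₚ.pigeonhole lt (funToFin ∘ f) =
  i , j , i<j , λ t → begin
    f i t                       ≡⟨ Finₚ.finToFun-funToFin (f i) t ⟨
    finToFun (funToFin (f i)) t ≡⟨ cong (λ r → finToFun r t) eq ⟩
    finToFun (funToFin (f j)) t ≡⟨ Finₚ.finToFun-funToFin (f j) t ⟩
    f j t                       ∎
  where open ≡-Reasoning

ball-size≤ : ∀ {n k N D} {C : List (Vec ℕ n)} → Resolving n k C →
  (b : Vec ℕ n) → IsVertex n k b →
  (U : Fin N → Vec ℕ n) → Injective _≡_ _≡_ U → (∀ i → IsVertex n k (U i)) → (∀ i → surplus (U i) b ≤ D) →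
  N ≤ suc (D + D) ^ length C
ball-size≤ {N = N} {D} {C} R b vb U U-injective vU near = ≮⇒≥ ¬windows<N
  where
  near-from-b : ∀ i → surplus b (U i) ≤ D
  near-from-b i = subst (_≤ D) (surplus-sym (U i) b (trans (vU i) (sym vb))) (near i)
  code : Fin N → Fin (length C) → Fin (suc (D + D))
  code i t = fromℕ< (offset< b (U i) (List.lookup C t) (near i))
  same-code⇒same-surplus : ∀ i j → (∀ t → code i t ≡ code j t) →
    ∀ z → z ∈ C → surplus (U i) z ≡ surplus (U j) z
  same-code⇒same-surplus i j agree z z∈C =
    subst (λ y → surplus (U i) y ≡ surplus (U j) y) (sym (lookup-index z∈C))
      (offset-injective b (U i) (U j) _ (near-from-b i) (near-from-b j)
        (trans (sym (Finₚ.toℕ-fromℕ< _)) (trans (cong toℕ (agree (index z∈C))) (Finₚ.toℕ-fromℕ< _))))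
  ¬windows<N : ¬ (suc (D + D) ^ length C < N)
  ¬windows<N lt with i , j , i<j , agree ← pigeonhole-pointwise lt code =
    Finₚ.<⇒≢ i<j (U-injective (resolving⇒separatesBySurplus R (U i) (U j) (vU i) (vU j)
      (same-code⇒same-surplus i j agree)))

funToFin-cong : ∀ {a b} {f g : Fin a → Fin b} → (∀ x → f x ≡ g x) → funToFin f ≡ funToFin g
funToFin-cong {zero}  _   = refl
funToFin-cong {suc a} f≗g = cong₂ combine (f≗g zero) (funToFin-cong (f≗g ∘ suc))

cell : ∀ {m p} → Fin (m ^ p) → Vec ℕ p
cell {m} {p} i = tabulate (toℕ ∘ finToFun {m} {p} i)

cell-injective : ∀ {m p} → Injective _≡_ _≡_ (cell {m} {p})
cell-injective {m} {p} {i} {j} eq = begin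
  i                              ≡⟨ Finₚ.funToFin-finToFin {p} {m} i ⟨
  funToFin (finToFun {m} {p} i)  ≡⟨ funToFin-cong same-coordinates ⟩
  funToFin (finToFun {m} {p} j)  ≡⟨ Finₚ.funToFin-finToFin {p} {m} j ⟩
  j                              ∎
  where
  open ≡-Reasoning
  same-coordinates : ∀ x → finToFun {m} {p} i x ≡ finToFun {m} {p} j x
  same-coordinates x = Finₚ.toℕ-injective (begin
    toℕ (finToFun {m} i x)         ≡⟨ lookup∘tabulate (toℕ ∘ finToFun {m} {p} i) x ⟨
    lookup (cell {m} {p} i) x      ≡⟨ cong (λ v → lookup v x) eq ⟩
    lookup (cell {m} {p} j) x      ≡⟨ lookup∘tabulate (toℕ ∘ finToFun {m} {p} j) x ⟩
    toℕ (finToFun {m} j x)         ∎)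

sum-tabulate-toℕ≤ : ∀ {p m} (f : Fin p → Fin m) → sum (tabulate (toℕ ∘ f)) ≤ p * m
sum-tabulate-toℕ≤ {zero}  f = z≤n
sum-tabulate-toℕ≤ {suc p} f = +-mono-≤ (<⇒≤ (Finₚ.toℕ<n (f zero))) (sum-tabulate-toℕ≤ (f ∘ suc))

padTo : ∀ {n} → ℕ → Vec ℕ n → Vec ℕ (suc n)
padTo k x = (k ∸ sum x) ∷ x

sum-padTo : ∀ {n k} (x : Vec ℕ n) → sum x ≤ k → sum (padTo k x) ≡ k
sum-padTo x sx≤k = m∸n+n≡m sx≤k

surplus-padTo-corner : ∀ {n} k (x : Vec ℕ n) → surplus (padTo k x) (corner k zero) ≡ sum x
surplus-padTo-corner k x = cong₂ _+_ (m≤n⇒m∸n≡0 (m∸n≤m k (sum x))) (surplus-replicate-0ʳ x)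

^-distribʳ-* : ∀ m n o → (m * n) ^ o ≡ m ^ o * n ^ o
^-distribʳ-* m n zero    = refl
^-distribʳ-* m n (suc o) = begin
  (m * n) * (m * n) ^ o      ≡⟨ cong ((m * n) *_) (^-distribʳ-* m n o) ⟩
  (m * n) * (m ^ o * n ^ o)  ≡⟨ *-interchange m n (m ^ o) (n ^ o) ⟩
  (m * m ^ o) * (n * n ^ o)  ∎
  where open ≡-Reasoning

-- With p = q + 1, the side m is chosen so that
-- (2pm + 1)^q ≤ ((2p + 1) m)^q = (2p + 1)^q m^q < m^(q+1).
side : ℕ → ℕ
side q = suc (suc (suc q + suc q) ^ q)

radius : ℕ → ℕ
radius q = suc q * side q

window^c<side^[1+q] : ∀ q {c} → c ≤ q → suc (radius q + radius q) ^ c < side q ^ suc q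
window^c<side^[1+q] q {c} c≤q = begin-strict
  W ^ c            ≤⟨ ^-monoʳ-≤ W c≤q ⟩
  W ^ q            ≤⟨ ^-monoˡ-≤ q W≤A*m ⟩
  (A * m) ^ q      ≡⟨ ^-distribʳ-* A m q ⟩
  A ^ q * m ^ q    <⟨ *-monoˡ-< (m ^ q) {{m^n≢0 m q}} (n<1+n (A ^ q)) ⟩
  m * m ^ q        ∎
  where
  open ≤-Reasoning
  A m W : ℕ
  A = suc (suc q + suc q)
  m = side q
  W = suc (radius q + radius q)
  W≤A*m : W ≤ A * m
  W≤A*m = +-mono-≤ (s≤s (z≤n {A ^ q})) (≤-reflexive (sym (*-distribʳ-+ m (suc q) (suc q))))

resolving-length≥ : ∀ q {k} → radius q ≤ k → (C : List (Vec ℕ (suc (suc q)))) →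
  Resolving (suc (suc q)) k C → suc q ≤ length C
resolving-length≥ q {k} k≥radius C R =
  ≮⇒≥ λ c<1+q → <⇒≱ (window^c<side^[1+q] q (s≤s⁻¹ c<1+q)) grid≤windows
  where
  point : Fin (side q ^ suc q) → Vec ℕ (suc q)
  point = cell {side q} {suc q}
  point≤radius : ∀ i → sum (point i) ≤ radius q
  point≤radius i = sum-tabulate-toℕ≤ (finToFun {side q} {suc q} i)
  grid≤windows : side q ^ suc q ≤ suc (radius q + radius q) ^ length C
  grid≤windows = ball-size≤ R (corner k zero) (sum-corner k (zero {suc q}))
    (padTo k ∘ point) (cell-injective ∘ cong tail)
    (λ i → sum-padTo (point i) (≤-trans (point≤radius i) k≥radius))
    (λ i → ≤-trans (≤-reflexive (surplus-padTo-corner k (point i))) (point≤radius i))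

mainTheorem10 : (n : ℕ) → 2 ≤ n → ∃ λ k₀ → (k : ℕ) → k₀ ≤ k → MetricDimensionKn n k (n ∸ 1)
mainTheorem10 (suc (suc q)) (s≤s (s≤s z≤n)) = suc (radius q) , λ k k₀≤k →
  (corners k , length-corners k , corners-unique k (≤-trans (s≤s z≤n) k₀≤k) , corners-resolving k) ,
  resolving-length≥ q (≤-trans (n≤1+n (radius q)) k₀≤k)
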